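{- Let $Y$ be a connected finite simple undirected graph with a cycle-edge $e=\{v,w\}$. Let $O^1,O^2\in\mathsf{Acyc}(Y)$ with $\mathcal{I}(O^1)=\mathcal{I}(O^2)=I$, where $I$ has at least two vertices. If $O^1$ and $O^2$ are not $\kappa$-equivalent (in $Y$), then the induced orientations $O^1_{Y_I}$ and $O^2_{Y_I}$ of $Y_I$ are not $\kappa$-equivalent (in $Y_I$).
   Context: $\mathsf{Acyc}(Z)$ is the set of acyclic orientations of a graph $Z$; a click converts a source into a sink by reversing its incident edges, and two acyclic orientations are $\kappa$-equivalent if one is obtained from the other by finitely many clicks. For $O\in\mathsf{Acyc}(Y)$, $i\le_O j$ if there is a directed path from $i$ to $j$; $\mathcal{I}(O)$ is the set of vertices $c$ with $v\le_O c\le_O w$ (with the relations inherited from $O$) when $v\le_O w$, and empty otherwise. For $I=\mathcal{I}(O)$, $Y_I$ is the graph obtained from $Y$ by contracting all vertices of $I$ to a single vertex $V_I$, and $O_{Y_I}$ is the orientation of $Y_I$ induced by $O$ (it is acyclic). -}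

module Defs where

open import Data.Nat using (ℕ; _≤_)
open import Data.Fin using (Fin)
open import Data.List using (List; []; _∷_; _∷ʳ_; length)
open import Data.List.Relation.Unary.Linked using (Linked)
open import Data.List.Relation.Unary.Unique.Propositional using (Unique)
open import Data.Product using (Σ; ∃; _×_; _,_)
open import Data.Sum using (_⊎_)
open import Data.Unit using (⊤)
open import Data.Empty using (⊥)
open import Data.Irrelevant using (Irrelevant)
open import Function.Bundles using (_↔_; _⇔_)
open import Relation.Nullary using (¬_)
open import Relation.Binary.PropositionalEquality using (_≡_; _≢_)
open import Relation.Binary.Construct.Closure.ReflexiveTransitive using (Star)

record Graph : Set₁ where
  constructor mkGraph
  field
    V   : Set
    _~_ : V → V → Set

open Graph public

FiniteSimple : Graph → Set
FiniteSimple Y =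
  (Σ ℕ λ n → V Y ↔ Fin n)
  × (∀ {x y} → _~_ Y x y → _~_ Y y x)
  × (∀ {x} → ¬ _~_ Y x x)
  × (∀ {x y} (p q : _~_ Y x y) → p ≡ q)                -- no multi-edges

Connected : Graph → Set
Connected Y = ∀ x y → Star (_~_ Y) x y

-- {v,w} is a cycle-edge: it is an edge lying on a cycle, i.e. there is a
-- cycle v , x₁ , … , xₖ , w , v  (k ≥ 1, all listed vertices distinct).
CycleEdge : (Y : Graph) → V Y → V Y → Set
CycleEdge Y v w =
  _~_ Y v w ×
  (Σ (List (V Y)) λ xs →
      (1 ≤ length xs)
    × Unique (v ∷ (xs ∷ʳ w))
    × Linked (_~_ Y) (v ∷ (xs ∷ʳ w)))

-- Orientations are given as relations  D x y  ("edge directed x → y").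

Orient : Graph → Set₁
Orient Y = V Y → V Y → Set

IsAcyclicOrientation : (Y : Graph) → Orient Y → Set
IsAcyclicOrientation Y D =
    (∀ {x y} → D x y → _~_ Y x y)
  × (∀ {x y} → _~_ Y x y → D x y ⊎ D y x)
  × (∀ {x y} → D x y → ¬ D y x)
  × (∀ {x y} → D x y → ¬ Star D y x)

Leq : (Y : Graph) → Orient Y → V Y → V Y → Set
Leq Y D i j = Star D i j

IsSource : {Y : Graph} → Orient Y → V Y → Set
IsSource {Y} D x = ∀ y → ¬ D y x

ClickAt : (Y : Graph) → Orient Y → V Y → Orient Y → Set
ClickAt Y D x D' =
  IsSource {Y} D x ×
  (∀ a b → D' a b ⇔ (((a ≡ x ⊎ b ≡ x) × D b a) ⊎ (a ≢ x × b ≢ x × D a b)))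

Click : (Y : Graph) → Orient Y → Orient Y → Set
Click Y D D' = Σ (V Y) λ x → ClickAt Y D x D'

κ-equiv : (Y : Graph) → Orient Y → Orient Y → Set₁
κ-equiv Y D₁ D₂ = Star (Click Y) D₁ D₂ ⊎ Star (Click Y) D₂ D₁

InI : {Y : Graph} → V Y → V Y → Orient Y → V Y → Set
InI {Y} v w D c = Leq Y D v c × Leq Y D c w

-- I(O¹) = I(O²) as sets with the relations inherited from O¹, O².
SameI : {Y : Graph} → V Y → V Y → Orient Y → Orient Y → Set
SameI {Y} v w D₁ D₂ =
    (∀ c → InI {Y} v w D₁ c ⇔ InI {Y} v w D₂ c)
  × (∀ c d → InI {Y} v w D₁ c → InI {Y} v w D₁ d →
       Leq Y D₁ c d ⇔ Leq Y D₂ c d)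

AtLeastTwo : {A : Set} → (A → Set) → Set
AtLeastTwo {A} P = Σ A λ a → Σ A λ b → a ≢ b × P a × P b

-- Contraction Y_P of the vertex set P to a single vertex V_P (= inj₂ _).

CV : (Y : Graph) → (V Y → Set) → Set
CV Y P = (Σ (V Y) λ x → Irrelevant (¬ P x)) ⊎ ⊤

liftRel : (Y : Graph) (P : V Y → Set) (R : V Y → V Y → Set) → CV Y P → CV Y P → Set
liftRel Y P R (Data.Sum.inj₁ (a , _)) (Data.Sum.inj₁ (b , _)) = R a b
liftRel Y P R (Data.Sum.inj₁ (a , _)) (Data.Sum.inj₂ _) = Σ (V Y) λ c → P c × R a c
liftRel Y P R (Data.Sum.inj₂ _) (Data.Sum.inj₁ (b , _)) = Σ (V Y) λ c → P c × R c b
liftRel Y P R (Data.Sum.inj₂ _) (Data.Sum.inj₂ _) = ⊥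

Contract : (Y : Graph) → (V Y → Set) → Graph
Contract Y P = mkGraph (CV Y P) (liftRel Y P (_~_ Y))

Induced : (Y : Graph) (P : V Y → Set) → Orient Y → Orient (Contract Y P)
Induced Y P D = liftRel Y P D

-- Work in Y with the orientation D lifted so far, keeping Ind D equivalent to the current
-- orientation of Y_I and D unchanged inside I. A click at an ordinary vertex of Y_I is the same
-- click in Y; a click at the contracted vertex V_I (a source) is realised by clicking the
-- vertices of I one by one in a topological order, which reverses exactly the edges leaving I.
-- At the end D induces O² on Y_I and agrees with O¹, hence with O², inside I (I(O¹) = I(O²)
-- with the same order); convexity of I in O² then forces D = O², so O¹ and O² would be
-- κ-equivalent. Classical choices (membership in I, sources, reachability) are made in the
-- double-negation monad, which finiteness of Y justifies and the negative goal permits.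

module Submission where

open import Level using (Level; 0ℓ) renaming (suc to lsuc)
open import Algebra.Bundles using (CommutativeRing)
open import Algebra.Properties.CommutativeSemigroup using (interchange)
open import Data.Bool using (Bool; true; false; _xor_; if_then_else_)
open import Data.Bool.Properties
  using (¬-not; xor-assoc; xor-comm; xor-same; xor-identityʳ; xor-∧-commutativeRing)
open import Data.Empty using (⊥-elim; ⊥-elim-irr)
open import Data.Fin as Fin using (Fin; zero; suc)
open import Data.Fin.Properties using (∀-cons)
open import Data.Fin.Subset using (Subset; _⊂_; _∈_)
open import Data.Fin.Subset.Induction using (⊂-wellFounded)
open import Data.Irrelevant using ([_])
open import Data.Nat using (ℕ; zero; suc)
open import Data.Product using (Σ; ∃; _×_; _,_; proj₂; swap)
open import Data.Sum as Sum using (_⊎_; inj₁; inj₂)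
open import Data.Unit using (tt)
open import Data.Vec using (tabulate)
open import Data.Vec.Properties using (lookup∘tabulate; []=⇒lookup; lookup⇒[]=)
open import Function using (_∘_; _$_; case_of_)
open import Function.Bundles using (_⇔_; mk⇔; Equivalence; _↔_; Inverse)
import Function.Properties.Equivalence as ⇔
open import Function.Properties.Inverse using (↔⇒↣)
open import Induction.WellFounded using (WellFounded; Acc; acc; module Subrelation)
open import Relation.Binary.Bundles using (Setoid)
import Relation.Binary.Construct.On as On
open import Relation.Binary.Construct.Closure.ReflexiveTransitive using (Star; ε; _◅_; _◅◅_)
import Relation.Binary.Construct.Closure.ReflexiveTransitive as Star
open import Relation.Binary.Definitions using (Symmetric; DecidableEquality)
open import Relation.Binary.PropositionalEquality
import Relation.Binary.Reasoning.Setoid as SetoidReasoning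
open import Relation.Nullary using (¬_; Dec; yes; no; does)
open import Relation.Nullary.Decidable
  using (via-injection; dec-true; dec-false; _×-dec_; ¬¬-excluded-middle)
open import Relation.Nullary.Negation using (contradiction; ¬¬-map)

open import Defs

private
  variable
    a b : Level
    X : Set a
    Z : Set b

_>>=_ : ¬ ¬ X → (X → ¬ ¬ Z) → ¬ ¬ Z
(¬¬x >>= f) ¬z = ¬¬x λ x → f x ¬z

return : X → ¬ ¬ X
return = contradiction

does-true : (x? : Dec X) → does x? ≡ true → X
does-true (yes x) _ = x

¬¬-∀-Fin : ∀ {n} {Q : Fin n → Set a} → (∀ i → ¬ ¬ Q i) → ¬ ¬ (∀ i → Q i)
¬¬-∀-Fin {n = zero}  _ = return λ ()
¬¬-∀-Fin {n = suc n} h = do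
  q₀ ← h zero
  qs ← ¬¬-∀-Fin (h ∘ suc)
  return (∀-cons q₀ qs)

module FiniteType {A : Set} {n : ℕ} (A↔Fin : A ↔ Fin n) where
  open Inverse A↔Fin

  _≟_ : DecidableEquality A
  _≟_ = via-injection (↔⇒↣ A↔Fin) Fin._≟_

  ¬¬-∀ : {Q : A → Set a} → (∀ x → ¬ ¬ Q x) → ¬ ¬ (∀ x → Q x)
  ¬¬-∀ {Q = Q} h = ¬¬-map (λ q x → subst Q (strictlyInverseʳ x) (q (to x))) (¬¬-∀-Fin (h ∘ from))

  ¬¬-decidable : (Q : A → Set) → ¬ ¬ (∀ x → Dec (Q x))
  ¬¬-decidable Q = ¬¬-∀ λ _ → ¬¬-excluded-middle

  ¬¬-decidable₂ : (R : A → A → Set) → ¬ ¬ (∀ x y → Dec (R x y))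
  ¬¬-decidable₂ R = ¬¬-∀ λ x → ¬¬-decidable (R x)

  ⌊_⌋ : (A → Bool) → Subset n
  ⌊ s ⌋ = tabulate (s ∘ from)

  _⊏_ : (A → Bool) → (A → Bool) → Set
  s ⊏ t = ⌊ s ⌋ ⊂ ⌊ t ⌋

  ⊏-wellFounded : WellFounded _⊏_
  ⊏-wellFounded = On.wellFounded ⌊_⌋ ⊂-wellFounded

  ∈⌊⌋⇒ : ∀ {s i} → i ∈ ⌊ s ⌋ → s (from i) ≡ true
  ∈⌊⌋⇒ {s} {i} i∈s = trans (sym (lookup∘tabulate (s ∘ from) i)) ([]=⇒lookup i∈s)

  ⇒∈⌊⌋ : ∀ {s i} → s (from i) ≡ true → i ∈ ⌊ s ⌋
  ⇒∈⌊⌋ {s} {i} si = lookup⇒[]= i _ (trans (lookup∘tabulate (s ∘ from) i) si)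

  ⊏-intro : ∀ {s t} → (∀ y → s y ≡ true → t y ≡ true) →
            ∀ x → t x ≡ true → s x ≡ false → s ⊏ t
  ⊏-intro {s} {t} s⊆t x tx sx =
    (λ i∈s → ⇒∈⌊⌋ {t} (s⊆t _ (∈⌊⌋⇒ {s} i∈s))) ,
    to x ,
    ⇒∈⌊⌋ {t} (subst (λ y → t y ≡ true) (sym (strictlyInverseʳ x)) tx) ,
    λ x∈s → case trans (sym sx) (subst (λ y → s y ≡ true) (strictlyInverseʳ x) (∈⌊⌋⇒ {s} x∈s))
            of λ ()

_≐_ : {A : Set} → (A → A → Set) → (A → A → Set) → Set
R ≐ S = ∀ a b → R a b ⇔ S a b

≐-refl : {A : Set} {R : A → A → Set} → R ≐ R
≐-refl _ _ = ⇔.refl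

≐-sym : {A : Set} {R S : A → A → Set} → R ≐ S → S ≐ R
≐-sym R≐S a b = ⇔.sym (R≐S a b)

≐-trans : {A : Set} {R S U : A → A → Set} → R ≐ S → S ≐ U → R ≐ U
≐-trans R≐S S≐U a b = ⇔.trans (R≐S a b) (S≐U a b)

≐-setoid : Set → Setoid (lsuc 0ℓ) 0ℓ
≐-setoid A = record
  { Carrier = A → A → Set
  ; _≈_ = _≐_
  ; isEquivalence = record { refl = ≐-refl ; sym = ≐-sym ; trans = ≐-trans }
  }

module ≐-Reasoning (A : Set) = SetoidReasoning (≐-setoid A)

module Flipping {A : Set} (_≟_ : DecidableEquality A) where

  ⁅_⁆ : A → A → Bool
  ⁅ x ⁆ y = does (y ≟ x)

  _⊕_ : (A → Bool) → (A → Bool) → A → Bool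
  (s ⊕ t) y = s y xor t y

  ⁅⁆-self : ∀ x → ⁅ x ⁆ x ≡ true
  ⁅⁆-self x = dec-true (x ≟ x) refl

  ⁅⁆-other : ∀ {x y} → y ≢ x → ⁅ x ⁆ y ≡ false
  ⁅⁆-other {x} {y} = dec-false (y ≟ x)

  click : (A → A → Set) → A → A → A → Set
  click D x a b = ((a ≡ x ⊎ b ≡ x) × D b a) ⊎ (a ≢ x × b ≢ x × D a b)

  Flip : (A → Bool) → (A → A → Set) → A → A → Set
  Flip s D a b = if s a xor s b then D b a else D a b

  Flip-cong : ∀ {s t D} → (∀ y → s y ≡ t y) → Flip s D ≐ Flip t D
  Flip-cong s≗t a b rewrite s≗t a | s≗t b = ⇔.refl

  Flip-resp : ∀ {s D E} → D ≐ E → Flip s D ≐ Flip s E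
  Flip-resp {s} D≐E a b with s a xor s b
  ... | true  = D≐E b a
  ... | false = D≐E a b

  Flip-same : ∀ {s D a b} → s a ≡ s b → Flip s D a b ⇔ D a b
  Flip-same {s} {b = b} sa≡sb rewrite sa≡sb | xor-same (s b) = ⇔.refl

  Flip-⊕ : ∀ s t D → Flip s (Flip t D) ≐ Flip (s ⊕ t) D
  Flip-⊕ s t D a b
    rewrite xor-comm (t b) (t a)
          | interchange (CommutativeRing.+-commutativeSemigroup xor-∧-commutativeRing)
                        (s a) (t a) (s b) (t b)
    with s a xor s b | t a xor t b
  ... | false | _     = ⇔.refl
  ... | true  | false = ⇔.refl
  ... | true  | true  = ⇔.refl

  Flip-split : ∀ s t D → Flip s D ≐ Flip (s ⊕ t) (Flip t D)
  Flip-split s t D = ≐-trans (Flip-cong cancel) (≐-sym (Flip-⊕ (s ⊕ t) t D))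
    where
    cancel : ∀ y → s y ≡ (s y xor t y) xor t y
    cancel y = sym (begin
      (s y xor t y) xor t y ≡⟨ xor-assoc (s y) (t y) (t y) ⟩
      s y xor (t y xor t y) ≡⟨ cong (s y xor_) (xor-same (t y)) ⟩
      s y xor false         ≡⟨ xor-identityʳ (s y) ⟩
      s y                   ∎)
      where open ≡-Reasoning

  click≐Flip : ∀ {D x} → click D x ≐ Flip ⁅ x ⁆ D
  click≐Flip {D} {x} a b with a ≟ x | b ≟ x
  ... | yes refl | yes refl = mk⇔ (λ { (inj₁ (_ , d)) → d
                                     ; (inj₂ (x≢x , _)) → contradiction refl x≢x })
                                  (λ d → inj₁ (inj₁ refl , d))
  ... | yes a≡x  | no _     = mk⇔ (λ { (inj₁ (_ , d)) → d
                                     ; (inj₂ (a≢x , _)) → contradiction a≡x a≢x })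
                                  (λ d → inj₁ (inj₁ a≡x , d))
  ... | no _     | yes b≡x  = mk⇔ (λ { (inj₁ (_ , d)) → d
                                     ; (inj₂ (_ , b≢x , _)) → contradiction b≡x b≢x })
                                  (λ d → inj₁ (inj₂ b≡x , d))
  ... | no a≢x   | no b≢x   = mk⇔ (λ { (inj₁ (inj₁ a≡x , _)) → contradiction a≡x a≢x
                                     ; (inj₁ (inj₂ b≡x , _)) → contradiction b≡x b≢x
                                     ; (inj₂ (_ , _ , d)) → d })
                                  (λ d → inj₂ (a≢x , b≢x , d))

module Orientations (G : Graph) (_≟_ : DecidableEquality (V G)) (~-sym : Symmetric (_~_ G)) where
  open Flipping _≟_

  Acyclic : Orient G → Set
  Acyclic = IsAcyclicOrientation G

  acyclic-resp : ∀ {D E} → D ≐ E → Acyclic D → Acyclic E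
  acyclic-resp {D} {E} D≐E (edge , total , asym , acyc) =
    edge ∘ from , Sum.map to to ∘ total , (λ e e′ → asym (from e) (from e′)) ,
    λ e p → acyc (from e) (Star.map from p)
    where
    to : ∀ {a b} → D a b → E a b
    to = Equivalence.to (D≐E _ _)
    from : ∀ {a b} → E a b → D a b
    from = Equivalence.from (D≐E _ _)

  click-acyclic : ∀ {D x} → Acyclic D → IsSource {G} D x → Acyclic (click D x)
  click-acyclic {D} {x} (edge , total , _ , acyc) src = edge′ , total′ , asym′ , acyc′
    where
    D′ = click D x

    x-sink : ∀ b → ¬ D′ x b
    x-sink b (inj₁ (_ , d)) = src b d
    x-sink b (inj₂ (x≢x , _)) = x≢x refl

    not-from-x : ∀ {a b} → Star D′ a b → b ≢ x → a ≢ x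
    not-from-x ε b≢x = b≢x
    not-from-x (d ◅ _) _ refl = x-sink _ d

    unclick-edge : ∀ {a b} → a ≢ x → b ≢ x → D′ a b → D a b
    unclick-edge a≢x _ (inj₁ (inj₁ a≡x , _)) = contradiction a≡x a≢x
    unclick-edge _ b≢x (inj₁ (inj₂ b≡x , _)) = contradiction b≡x b≢x
    unclick-edge _ _ (inj₂ (_ , _ , d)) = d

    unclick : ∀ {a b} → Star D′ a b → b ≢ x → Star D a b
    unclick ε _ = ε
    unclick (d ◅ p) b≢x =
      unclick-edge (not-from-x (d ◅ p) b≢x) (not-from-x p b≢x) d ◅ unclick p b≢x

    edge′ : ∀ {a b} → D′ a b → _~_ G a b
    edge′ (inj₁ (_ , d)) = ~-sym (edge d)
    edge′ (inj₂ (_ , _ , d)) = edge d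

    total′ : ∀ {a b} → _~_ G a b → D′ a b ⊎ D′ b a
    total′ {a} {b} a~b with a ≟ x | b ≟ x | total a~b
    ... | yes a≡x | _       | inj₁ d = inj₂ (inj₁ (inj₂ a≡x , d))
    ... | yes a≡x | _       | inj₂ d = inj₁ (inj₁ (inj₁ a≡x , d))
    ... | no _    | yes b≡x | inj₁ d = inj₂ (inj₁ (inj₁ b≡x , d))
    ... | no _    | yes b≡x | inj₂ d = inj₁ (inj₁ (inj₂ b≡x , d))
    ... | no a≢x  | no b≢x  | inj₁ d = inj₁ (inj₂ (a≢x , b≢x , d))
    ... | no a≢x  | no b≢x  | inj₂ d = inj₂ (inj₂ (b≢x , a≢x , d))

    acyc′ : ∀ {a b} → D′ a b → ¬ Star D′ b a
    acyc′ {a} {b} d p = acyc (unclick-edge a≢x (not-from-x p a≢x) d) (unclick p a≢x)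
      where
      a≢x : a ≢ x
      a≢x refl = x-sink b d

    asym′ : ∀ {a b} → D′ a b → ¬ D′ b a
    asym′ d d′ = acyc′ d (d′ ◅ ε)

  clicks-acyclic : ∀ {D E} → Star (Click G) D E → Acyclic D → Acyclic E
  clicks-acyclic ε ao = ao
  clicks-acyclic ((_ , src , E≐) ◅ cs) ao =
    clicks-acyclic cs (acyclic-resp (≐-sym E≐) (click-acyclic ao src))

  acyclic-⊆⇒≐ : ∀ {D E} → Acyclic D → Acyclic E → (∀ {a b} → D a b → E a b) → D ≐ E
  acyclic-⊆⇒≐ {D} {E} (_ , totalD , _ , _) (edgeE , _ , asymE , _) D⊆E a b = mk⇔ D⊆E E⊆D
    where
    E⊆D : E a b → D a b
    E⊆D e with totalD (edgeE e)
    ... | inj₁ d = d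
    ... | inj₂ d = contradiction (D⊆E d) (asymE e)

  orientation-from-reach : ∀ {D E a b} → Acyclic D → Acyclic E →
                           (Star D a b → Star E a b) → D a b → E a b
  orientation-from-reach (edgeD , _ , _ , _) (_ , totalE , _ , acycE) reach d
    with totalE (edgeD d)
  ... | inj₁ e = e
  ... | inj₂ e = contradiction (reach (d ◅ ε)) (acycE e)

module FiniteGraph (G : Graph) (~-sym : Symmetric (_~_ G)) {n} (V↔Fin : V G ↔ Fin n) where
  open FiniteType V↔Fin public
  open Flipping _≟_ public
  open Orientations G _≟_ ~-sym public

  PredClosed : Orient G → (V G → Bool) → Set
  PredClosed D s = ∀ {y z} → D y z → s z ≡ true → s y ≡ true

  acyclic⇒wellFounded : ∀ {D} → Acyclic D → (∀ x y → Dec (Star D x y)) → WellFounded D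
  acyclic⇒wellFounded {D} (_ , _ , _ , acyc) star? =
    Subrelation.wellFounded ancestors-⊏ (On.wellFounded ancestors ⊏-wellFounded)
    where
    ancestors : V G → V G → Bool
    ancestors x y = does (star? y x)

    ancestors-⊏ : ∀ {y x} → D y x → ancestors y ⊏ ancestors x
    ancestors-⊏ {y} {x} d =
      ⊏-intro {ancestors y} {ancestors x}
        (λ z z⇝y → dec-true (star? z x) (does-true (star? z y) z⇝y ◅◅ d ◅ ε))
        x (dec-true (star? x x) ε) (dec-false (star? x y) (acyc d))

  ¬¬-source : ∀ {D s x₀} → Acyclic D → PredClosed D s → s x₀ ≡ true →
              ¬ ¬ (∃ λ x → s x ≡ true × IsSource {G} D x)
  ¬¬-source {D} {s} {x₀} ao closed sx₀ = do
    star? ← ¬¬-decidable₂ (Star D)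
    descend (acyclic⇒wellFounded ao star? x₀) sx₀
    where
    descend : ∀ {x} → Acc D x → s x ≡ true → ¬ ¬ (∃ λ x → s x ≡ true × IsSource {G} D x)
    descend {x} (acc rs) sx = do
      pred? ← ¬¬-excluded-middle {A = ∃ λ y → D y x}
      case pred? of λ where
        (yes (y , d)) → descend (rs d) (closed d sx)
        (no none)     → return (x , sx , λ y d → none (y , d))

  ⊕⁅⁆-self : ∀ {s x} → s x ≡ true → (s ⊕ ⁅ x ⁆) x ≡ false
  ⊕⁅⁆-self {x = x} sx rewrite sx | ⁅⁆-self x = refl

  ⊕⁅⁆-other : ∀ {s x y} → y ≢ x → (s ⊕ ⁅ x ⁆) y ≡ s y
  ⊕⁅⁆-other {s} {y = y} y≢x rewrite ⁅⁆-other y≢x = xor-identityʳ (s y)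

  ⊕⁅⁆-⊏ : ∀ {s x} → s x ≡ true → (s ⊕ ⁅ x ⁆) ⊏ s
  ⊕⁅⁆-⊏ {s} {x} sx = ⊏-intro {s ⊕ ⁅ x ⁆} {s} shrinks x sx (⊕⁅⁆-self {s} sx)
    where
    shrinks : ∀ y → (s ⊕ ⁅ x ⁆) y ≡ true → s y ≡ true
    shrinks y s′y with y ≟ x
    ... | yes refl = case trans (sym s′y) (⊕⁅⁆-self {s} sx) of λ ()
    ... | no y≢x   = trans (sym (⊕⁅⁆-other {s} y≢x)) s′y

  ⊕⁅⁆-closed : ∀ {D s x} → IsSource {G} D x → s x ≡ true → PredClosed D s →
               PredClosed (click D x) (s ⊕ ⁅ x ⁆)
  ⊕⁅⁆-closed src _ _ (inj₁ (inj₁ refl , d)) _ = ⊥-elim (src _ d)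
  ⊕⁅⁆-closed {s = s} _ sx _ (inj₁ (inj₂ refl , _)) s′x =
    case trans (sym s′x) (⊕⁅⁆-self {s} sx) of λ ()
  ⊕⁅⁆-closed {s = s} _ _ closed (inj₂ (y≢x , z≢x , d)) s′z =
    trans (⊕⁅⁆-other {s} y≢x) (closed d (trans (sym (⊕⁅⁆-other {s} z≢x)) s′z))

  flip-closed : ∀ {D E s x₀} → Acyclic D → PredClosed D s → s x₀ ≡ true → E ≐ Flip s D →
                ¬ ¬ Star (Click G) D E
  flip-closed {s = s} = go (⊏-wellFounded s)
    where
    go : ∀ {D E s x₀} → Acc _⊏_ s → Acyclic D → PredClosed D s → s x₀ ≡ true → E ≐ Flip s D →
         ¬ ¬ Star (Click G) D E
    go {D} {E} {s} (acc smaller) ao closed sx₀ E≐ = do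
      (x , sx , src) ← ¬¬-source ao closed sx₀
      let E≐rest : E ≐ Flip (s ⊕ ⁅ x ⁆) (click D x)
          E≐rest = begin
            E                                ≈⟨ E≐ ⟩
            Flip s D                         ≈⟨ Flip-split s ⁅ x ⁆ D ⟩
            Flip (s ⊕ ⁅ x ⁆) (Flip ⁅ x ⁆ D)  ≈⟨ Flip-resp {s ⊕ ⁅ x ⁆} (≐-sym click≐Flip) ⟩
            Flip (s ⊕ ⁅ x ⁆) (click D x)     ∎
          first = x , src , ≐-refl
      rest? ← ¬¬-excluded-middle {A = ∃ λ y → (s ⊕ ⁅ x ⁆) y ≡ true}
      case rest? of λ where
        (yes (_ , s′y)) → ¬¬-map (first ◅_) $
          go (smaller (⊕⁅⁆-⊏ {s} sx)) (click-acyclic ao src)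
             (⊕⁅⁆-closed {s = s} src sx closed) s′y E≐rest
        (no empty) → return $
          (x , src , ≐-trans E≐rest (Flip-cong λ y → ¬-not (empty ∘ (y ,_)))) ◅ ε
      where open ≐-Reasoning (V G)

Convex : (Y : Graph) → (V Y → Set) → Orient Y → Set
Convex Y P D = ∀ {c a c′} → P c → P c′ → D c a → D a c′ → P a

InI-convex : ∀ {Y : Graph} {v w} (D : Orient Y) → Convex Y (InI {Y} v w D) D
InI-convex _ (v⇝c , _) (_ , c′⇝w) d d′ = v⇝c ◅◅ d ◅ ε , d′ ◅ c′⇝w

module Contraction (Y : Graph) (~-sym : Symmetric (_~_ Y)) {n} (V↔Fin : V Y ↔ Fin n)
                   (P : V Y → Set) (P? : ∀ y → Dec (P y)) {p₀ : V Y} (p₀∈P : P p₀) where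
  open FiniteGraph Y ~-sym V↔Fin

  Ỹ : Graph
  Ỹ = Contract Y P

  V-P : V Ỹ
  V-P = inj₂ tt

  Ind : Orient Y → Orient Ỹ
  Ind = Induced Y P

  _≟̃_ : DecidableEquality (V Ỹ)
  inj₁ (a , _) ≟̃ inj₁ (b , _) with a ≟ b
  ... | yes refl = yes refl
  ... | no a≢b   = no λ { refl → a≢b refl }
  inj₁ _ ≟̃ inj₂ _ = no λ ()
  inj₂ _ ≟̃ inj₁ _ = no λ ()
  inj₂ tt ≟̃ inj₂ tt = yes refl

  module F̃ = Flipping _≟̃_

  quot : V Y → V Ỹ
  quot y with P? y
  ... | yes _   = V-P
  ... | no y∉P  = inj₁ (y , [ y∉P ])

  quot-inside : ∀ {y} → P y → quot y ≡ V-P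
  quot-inside {y} y∈P with P? y
  ... | yes _   = refl
  ... | no y∉P  = contradiction y∈P y∉P

  quot-outside : ∀ {y} .(y∉P : ¬ P y) → quot y ≡ inj₁ (y , [ y∉P ])
  quot-outside {y} y∉P with P? y
  ... | yes y∈P = ⊥-elim-irr (y∉P y∈P)
  ... | no _    = refl

  quot-surjective : ∀ x → ∃ λ y → quot y ≡ x
  quot-surjective (inj₁ (a , [ a∉P ])) = a , quot-outside a∉P
  quot-surjective (inj₂ tt) = p₀ , quot-inside p₀∈P

  Ind-quot : ∀ {D y z} → D y z → ¬ (P y × P z) → Ind D (quot y) (quot z)
  Ind-quot {y = y} {z} d not-both with P? y | P? z
  ... | yes y∈P | yes z∈P = contradiction (y∈P , z∈P) not-both
  ... | yes y∈P | no _    = y , y∈P , d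
  ... | no _    | yes z∈P = z , z∈P , d
  ... | no _    | no _    = d

  Ind-asym : ∀ {T} → Acyclic T → Convex Y P T → ∀ {u v} → Ind T u v → ¬ Ind T v u
  Ind-asym (_ , _ , asym , _) _ {inj₁ _} {inj₁ _} t t′ = asym t t′
  Ind-asym _ convex {inj₁ (_ , [ a∉P ])} {inj₂ _} (_ , c∈P , t) (_ , c′∈P , t′) =
    ⊥-elim-irr (a∉P (convex c′∈P c∈P t′ t))
  Ind-asym _ convex {inj₂ _} {inj₁ (_ , [ a∉P ])} (_ , c∈P , t) (_ , c′∈P , t′) =
    ⊥-elim-irr (a∉P (convex c∈P c′∈P t t′))

  Σ∈P : (V Y → Set) → Set
  Σ∈P X = Σ (V Y) λ c → P c × X c

  Σ∈P-cong : ∀ {X Z : V Y → Set} → (∀ {c} → P c → X c ⇔ Z c) → Σ∈P X ⇔ Σ∈P Z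
  Σ∈P-cong X⇔Z = mk⇔ (λ (c , c∈P , x) → c , c∈P , Equivalence.to (X⇔Z c∈P) x)
                     (λ (c , c∈P , z) → c , c∈P , Equivalence.from (X⇔Z c∈P) z)

  if-Σ∈P : ∀ β {X Z : V Y → Set} →
           (if β then Σ∈P X else Σ∈P Z) ⇔ Σ∈P (λ c → if β then X c else Z c)
  if-Σ∈P true  = ⇔.refl
  if-Σ∈P false = ⇔.refl

  Flip-Ind : ∀ t D → F̃.Flip t (Ind D) ≐ Ind (Flip (t ∘ quot) D)
  Flip-Ind t D (inj₁ (a , [ a∉P ])) (inj₁ (b , [ b∉P ]))
    rewrite quot-outside a∉P | quot-outside b∉P = ⇔.refl
  Flip-Ind t D (inj₁ (a , [ a∉P ])) (inj₂ tt) =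
    ⇔.trans (if-Σ∈P (t (inj₁ (a , [ a∉P ])) xor t V-P)) (Σ∈P-cong weight)
    where
    weight : ∀ {c} → P c → _ ⇔ Flip (t ∘ quot) D a c
    weight c∈P rewrite quot-outside a∉P | quot-inside c∈P = ⇔.refl
  Flip-Ind t D (inj₂ tt) (inj₁ (a , [ a∉P ])) =
    ⇔.trans (if-Σ∈P (t V-P xor t (inj₁ (a , [ a∉P ])))) (Σ∈P-cong weight)
    where
    weight : ∀ {c} → P c → _ ⇔ Flip (t ∘ quot) D c a
    weight c∈P rewrite quot-outside a∉P | quot-inside c∈P = ⇔.refl
  Flip-Ind t D (inj₂ tt) (inj₂ tt) with t V-P xor t V-P
  ... | true  = ⇔.refl
  ... | false = ⇔.refl

  fibre-closed : ∀ {D x} → IsSource {Ỹ} (Ind D) x → PredClosed D (F̃.⁅ x ⁆ ∘ quot)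
  fibre-closed {D} {x} src {y} {z} d z∈fibre with quot y ≟̃ x
  ... | yes _    = refl
  ... | no qy≢x  = ⊥-elim (src (quot y) (subst (Ind D (quot y)) qz≡x (Ind-quot d not-both)))
    where
    qz≡x : quot z ≡ x
    qz≡x = does-true (quot z ≟̃ x) z∈fibre
    not-both : ¬ (P y × P z)
    not-both (y∈P , z∈P) =
      qy≢x (trans (quot-inside y∈P) (trans (sym (quot-inside z∈P)) qz≡x))

  fibre-nonempty : ∀ x → ∃ λ y → F̃.⁅ x ⁆ (quot y) ≡ true
  fibre-nonempty x with quot-surjective x
  ... | y , qy≡x = y , dec-true (quot y ≟̃ x) qy≡x

  record Lifted (D₀ : Orient Y) (D̃ : Orient Ỹ) : Set₁ where
    constructor lifted
    field
      {D}    : Orient Y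
      clicks : Star (Click Y) D₀ D
      ind    : D̃ ≐ Ind D
      inside : ∀ {c d} → P c → P d → D c d → D₀ c d

  -- A click at x in Ỹ is realised in Y by flipping the fibre of x, which is predecessor-closed
  -- because x is a source: for x ≠ V-P this is the click at x, for x = V-P it reverses all
  -- edges leaving P.
  lift-click : ∀ {D₀ D̃ D̃′} → Acyclic D₀ → Click Ỹ D̃ D̃′ → Lifted D₀ D̃ → ¬ ¬ Lifted D₀ D̃′
  lift-click {D₀} {D̃} {D̃′} ao₀ (x , src , D̃′≐) (lifted {D} clicks ind inside) = do
    clicks′ ← flip-closed (clicks-acyclic clicks ao₀) (fibre-closed src′)
                          (proj₂ (fibre-nonempty x)) ≐-refl
    return (lifted (clicks ◅◅ clicks′) ind′ inside′)
    where
    fibre : V Y → Bool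
    fibre = F̃.⁅ x ⁆ ∘ quot

    src′ : IsSource {Ỹ} (Ind D) x
    src′ y d = src y (Equivalence.from (ind y x) d)

    ind′ : D̃′ ≐ Ind (Flip fibre D)
    ind′ = begin
      D̃′                        ≈⟨ D̃′≐ ⟩
      F̃.click D̃ x              ≈⟨ F̃.click≐Flip ⟩
      F̃.Flip F̃.⁅ x ⁆ D̃        ≈⟨ F̃.Flip-resp {F̃.⁅ x ⁆} ind ⟩
      F̃.Flip F̃.⁅ x ⁆ (Ind D)  ≈⟨ Flip-Ind F̃.⁅ x ⁆ D ⟩
      Ind (Flip fibre D)        ∎
      where open ≐-Reasoning (V Ỹ)

    inside′ : ∀ {c d} → P c → P d → Flip fibre D c d → D₀ c d
    inside′ c∈P d∈P = inside c∈P d∈P ∘ Equivalence.to (Flip-same {fibre} {D} same-fibre)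
      where
      same-fibre = cong F̃.⁅ x ⁆ (trans (quot-inside c∈P) (sym (quot-inside d∈P)))

  lift-clicks : ∀ {D₀ D̃ D̃′} → Acyclic D₀ → Star (Click Ỹ) D̃ D̃′ →
                Lifted D₀ D̃ → ¬ ¬ Lifted D₀ D̃′
  lift-clicks _ ε L = return L
  lift-clicks ao₀ (c ◅ cs) L = lift-click ao₀ c L >>= lift-clicks ao₀ cs

  Ind-reflects-≐ : ∀ {D T} → Acyclic D → Acyclic T → Convex Y P T → Ind T ≐ Ind D →
                  (∀ {c d} → P c → P d → D c d → T c d) → D ≐ T
  Ind-reflects-≐ {D} {T} aoD@(edge , _ , _ , _) aoT@(_ , total , _ , _) convex Ind≐ agree =
    acyclic-⊆⇒≐ aoD aoT D⊆T
    where
    D⊆T : ∀ {a b} → D a b → T a b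
    D⊆T {a} {b} d with total (edge d)
    ... | inj₁ t = t
    ... | inj₂ t with P? a ×-dec P? b
    ...   | yes (a∈P , b∈P) = agree a∈P b∈P d
    ...   | no not-both =
      ⊥-elim $ Ind-asym aoT convex {quot a} {quot b}
                 (Equivalence.from (Ind≐ (quot a) (quot b)) (Ind-quot {D} d not-both))
                 (Ind-quot {T} t (not-both ∘ swap))

  lift-path : ∀ {D₀ T} → Acyclic D₀ → Acyclic T → Convex Y P T →
              (∀ {c d} → P c → P d → D₀ c d → T c d) →
              Star (Click Ỹ) (Ind D₀) (Ind T) → ¬ ¬ Star (Click Y) D₀ T
  lift-path ao₀ aoT convex agree clicks̃ = do
    lifted clicks ind inside ← lift-clicks ao₀ clicks̃ (lifted ε ≐-refl λ _ _ d → d)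
    let aoD = clicks-acyclic clicks ao₀
        D≐T = Ind-reflects-≐ aoD aoT convex ind λ c∈P d∈P →
                agree c∈P d∈P ∘ inside c∈P d∈P
    -- Flipping all of Y changes nothing; it turns the pointwise D ≐ T into an actual
    -- sequence of clicks ending at T itself.
    round ← flip-closed {s = λ _ → true} {x₀ = p₀} aoD (λ _ _ → refl) refl (≐-sym D≐T)
    return (clicks ◅◅ round)

proposition10 :
    (Y : Graph) → FiniteSimple Y → Connected Y →
    (v w : V Y) → CycleEdge Y v w →
    (O¹ O² : Orient Y) →
    IsAcyclicOrientation Y O¹ → IsAcyclicOrientation Y O² →
    SameI {Y} v w O¹ O² →
    AtLeastTwo (InI {Y} v w O¹) →
    ¬ κ-equiv Y O¹ O² →
    ¬ κ-equiv (Contract Y (InI {Y} v w O¹))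
              (Induced Y (InI {Y} v w O¹) O¹)
              (Induced Y (InI {Y} v w O¹) O²)
proposition10 Y ((_ , V↔Fin) , ~-sym , _) _ v w _ O¹ O² ao¹ ao² (sameI , sameLeq)
              (p₀ , _ , _ , p₀∈I , _) O¹≁O² κ̃ =
  ¬¬-decidable I λ I? →
    let open Contraction Y ~-sym V↔Fin I I? p₀∈I in
    Sum.[ (λ path → lift-path ao¹ ao² convex² agree¹² path (O¹≁O² ∘ inj₁))
        , (λ path → lift-path ao² ao¹ convex¹ agree²¹ path (O¹≁O² ∘ inj₂)) ]′ κ̃
  where
  open FiniteGraph Y ~-sym V↔Fin using (¬¬-decidable; orientation-from-reach)

  I : V Y → Set
  I = InI {Y} v w O¹

  convex¹ : Convex Y I O¹
  convex¹ = InI-convex {Y} {v} {w} O¹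

  convex² : Convex Y I O²
  convex² {a = a} c∈I c′∈I d d′ = Equivalence.from (sameI a)
    (InI-convex {Y} {v} {w} O² (Equivalence.to (sameI _) c∈I)
                                (Equivalence.to (sameI _) c′∈I) d d′)

  agree¹² : ∀ {c d} → I c → I d → O¹ c d → O² c d
  agree¹² c∈I d∈I = orientation-from-reach ao¹ ao² (Equivalence.to (sameLeq _ _ c∈I d∈I))

  agree²¹ : ∀ {c d} → I c → I d → O² c d → O¹ c d
  agree²¹ c∈I d∈I = orientation-from-reach ao² ao¹ (Equivalence.from (sameLeq _ _ c∈I d∈I))
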